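{- Let $\ell\ge2$ be an integer. Then the smallest element of $\overline{\mathcal{V}}_\ell$ is $F_\ell$. Moreover, for each integer $i\ge\ell$, the map $\bar\iota$ restricts to an order preserving bijection from $\overline{\mathcal{V}}_\ell\cap\,]F_i,F_{i+1}[$ to $\overline{\mathcal{V}}_\ell\cap\,]F_{i-3},F_{i-1}+F_{i-3}[$.
   Context: Fibonacci numbers: $F_{ -1}=0$, $F_0=1$, $F_{i+2}=F_{i+1}+F_i$; $\overline{\mathcal{F}}=\{F_i: i\ge-1\}$. Define $\bar\iota:\mathbb{N}\to\mathbb{N}$ by $\bar\iota(x)=x$ if $x\in\overline{\mathcal{F}}$, and $\bar\iota(x)=x-2F_{i-2}$ if $F_i<x<F_{i+1}$ for an integer $i\ge3$. Define $\bar\alpha(x)=\lim_{k\to\infty}\bar\iota^k(x)$ (the iterates are eventually constant). For $\ell\ge1$, $\overline{\mathcal{V}}_\ell=\{x\in\mathbb{N}: \bar\alpha(x)\ge F_\ell\}$. Here $]a,b[$ denotes the open interval. -}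

module Defs where

open import Data.Nat using (ℕ; zero; suc; _+_; _*_; _∸_; _≤_; _<_; _≤?_)
open import Data.Nat.Properties using (_≟_)
open import Data.Product using (Σ; _×_)
open import Function using (_∘_)
open import Relation.Nullary using (yes; no)
open import Relation.Binary.PropositionalEquality using (_≡_)

-- Shifted Fibonacci numbers: fib n = F_{n-1} in the paper's indexing
-- (F_{-1} = 0, F_0 = 1, F_{i+2} = F_{i+1} + F_i).
-- So fib 0 = 0, fib 1 = 1, fib 2 = 1, fib 3 = 2, fib 4 = 3, fib 5 = 5, ...
fib : ℕ → ℕ
fib zero = 0
fib (suc zero) = 1
fib (suc (suc n)) = fib (suc n) + fib n

F : ℕ → ℕ
F i = fib (suc i)

lastLe : ℕ → ℕ → ℕ
lastLe x zero = zero
lastLe x (suc n) with fib (suc n) ≤? x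
... | yes _ = suc n
... | no _ = lastLe x n

-- ι̅: identity on Fibonacci numbers; otherwise, with F_i < x < F_{i+1}
-- (i ≥ 3 automatically), ι̅ x = x - 2 F_{i-2}.
-- k = lastLe x (x+2) is the largest shifted index with fib k ≤ x
-- (fib (x+2) > x), i.e. F_{k-1} ≤ x < F_k; for x not Fibonacci, i = k-1,
-- so F_{i-2} = fib (k-2).
iotaBar : ℕ → ℕ
iotaBar x with lastLe x (suc (suc x))
... | k with fib k ≟ x
...   | yes _ = x
...   | no _ = x ∸ 2 * fib (k ∸ 2)

iter : (ℕ → ℕ) → ℕ → ℕ → ℕ
iter f zero x = x
iter f (suc k) x = f (iter f k x)

-- ᾱ(x) = y : the iterates ι̅^k(x) are eventually constant equal to y
-- (this is the limit of the sequence in the discrete space ℕ).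
AlphaBarIs : ℕ → ℕ → Set
AlphaBarIs x y = Σ ℕ λ K → ∀ k → K ≤ k → iter iotaBar k x ≡ y

InV : ℕ → ℕ → Set
InV ℓ x = Σ ℕ λ y → AlphaBarIs x y × F ℓ ≤ y

-- On ]F_i, F_{i+1}[ the map ι̅ is the translation x ↦ x − 2F_{i−2}, and
-- F_{i+1} = 2F_{i−2} + (F_{i−1} + F_{i−3}), F_i = 2F_{i−2} + F_{i−3}; so it carries
-- this interval increasingly onto ]F_{i−3}, F_{i−1} + F_{i−3}[. Membership in V̄_ℓ only
-- depends on the limit ᾱ, which ι̅ does not change, so ι̅ preserves V̄_ℓ in both
-- directions. Finally ι̅ never increases its argument and fixes Fibonacci numbers,
-- whence ᾱ(x) ≤ x and F_ℓ is the least element of V̄_ℓ.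
{-# OPTIONS --safe #-}
module Submission where

open import Defs
open import Data.Nat using (ℕ; zero; suc; _+_; _*_; _∸_; _≤_; _<_; _≤′_; ≤′-refl; ≤′-step; z≤n; s≤s; _≤?_)
open import Data.Nat.Properties
open import Data.Nat.Tactic.RingSolver using (solve-∀)
open import Data.Product using (Σ; _×_; _,_)
open import Data.Sum using (inj₁; inj₂)
open import Relation.Nullary using (yes; no; contradiction)
open import Relation.Binary.PropositionalEquality

fib-≤-suc : ∀ n → fib n ≤ fib (suc n)
fib-≤-suc zero = z≤n
fib-≤-suc (suc zero) = ≤-refl
fib-≤-suc (suc (suc n)) = m≤m+n _ _

fib-mono-≤′ : ∀ {m n} → m ≤′ n → fib m ≤ fib n
fib-mono-≤′ ≤′-refl = ≤-refl
fib-mono-≤′ (≤′-step {n} m≤′n) = ≤-trans (fib-mono-≤′ m≤′n) (fib-≤-suc n)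

fib-mono-≤ : ∀ {m n} → m ≤ n → fib m ≤ fib n
fib-mono-≤ m≤n = fib-mono-≤′ (≤⇒≤′ m≤n)

fib-suc-pos : ∀ n → 0 < fib (suc n)
fib-suc-pos zero = ≤-refl
fib-suc-pos (suc n) = ≤-trans (fib-suc-pos n) (m≤m+n _ _)

fib-<-suc : ∀ n → fib (2 + n) < fib (3 + n)
fib-<-suc n = begin-strict
  fib (2 + n)               ≡⟨ +-identityʳ _ ⟨
  fib (2 + n) + 0           <⟨ +-monoʳ-< (fib (2 + n)) (fib-suc-pos n) ⟩
  fib (2 + n) + fib (1 + n) ∎
  where open ≤-Reasoning

n≤1+fib : ∀ n → n ≤ suc (fib n)
n≤1+fib 0 = z≤n
n≤1+fib 1 = s≤s z≤n
n≤1+fib 2 = ≤-refl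
n≤1+fib (suc (suc (suc n))) = begin
  3 + n                                 ≤⟨ s≤s (n≤1+fib (suc (suc n))) ⟩
  2 + fib (2 + n)                       ≡⟨ cong suc (+-comm 1 (fib (2 + n))) ⟩
  suc (fib (2 + n) + 1)                 ≤⟨ s≤s (+-monoʳ-≤ (fib (2 + n)) (fib-suc-pos n)) ⟩
  suc (fib (2 + n) + fib (1 + n))       ∎
  where open ≤-Reasoning

lastLe-≡ : ∀ x m n → m ≤ n → fib m ≤ x → (∀ p → m < p → p ≤ n → x < fib p) →
           lastLe x n ≡ m
lastLe-≡ x zero zero _ _ _ = refl
lastLe-≡ x m (suc n) m≤1+n fibm≤x above with fib (suc n) ≤? x | m≤n⇒m<n∨m≡n m≤1+n
... | yes fib1+n≤x | inj₁ m<1+n = contradiction fib1+n≤x (<⇒≱ (above (suc n) m<1+n ≤-refl))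
... | yes _        | inj₂ m≡1+n = sym m≡1+n
... | no _         | inj₁ (s≤s m≤n) =
  lastLe-≡ x m n m≤n fibm≤x (λ p m<p p≤n → above p m<p (m≤n⇒m≤1+n p≤n))
... | no fib1+n≰x  | inj₂ refl = contradiction fibm≤x fib1+n≰x

lastLe-between : ∀ {x k} → fib k ≤ x → x < fib (suc k) → lastLe x (2 + x) ≡ k
lastLe-between {x} {k} fibk≤x x<fib1+k = lastLe-≡ x k (2 + x) k≤2+x fibk≤x
  (λ p k<p _ → <-≤-trans x<fib1+k (fib-mono-≤ k<p))
  where
  k≤2+x : k ≤ 2 + x
  k≤2+x = ≤-trans (n≤1+fib k) (m≤n⇒m≤1+n (s≤s fibk≤x))

iotaBar-fib : ∀ n → iotaBar (fib (2 + n)) ≡ fib (2 + n)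
iotaBar-fib n rewrite lastLe-between {fib (2 + n)} {2 + n} ≤-refl (fib-<-suc n)
  with fib (2 + n) ≟ fib (2 + n)
... | yes _ = refl
... | no fib≢fib = contradiction refl fib≢fib

iotaBar-between : ∀ j x → fib (3 + j) < x → x < fib (4 + j) →
                  iotaBar x ≡ x ∸ 2 * fib (1 + j)
iotaBar-between j x fib3+j<x x<fib4+j
  rewrite lastLe-between {x} {3 + j} (<⇒≤ fib3+j<x) x<fib4+j
  with fib (3 + j) ≟ x
... | yes fib3+j≡x = contradiction fib3+j≡x (<⇒≢ fib3+j<x)
... | no _ = refl

iotaBar-≤ : ∀ x → iotaBar x ≤ x
iotaBar-≤ x with lastLe x (2 + x)
... | k with fib k ≟ x
...   | yes _ = ≤-refl
...   | no _ = m∸n≤m x (2 * fib (k ∸ 2))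

IterLimit : (ℕ → ℕ) → ℕ → ℕ → Set
IterLimit f x y = Σ ℕ λ K → ∀ k → K ≤ k → iter f k x ≡ y

module _ {f : ℕ → ℕ} where

  iter-comm : ∀ k x → iter f k (f x) ≡ f (iter f k x)
  iter-comm zero x = refl
  iter-comm (suc k) x = cong f (iter-comm k x)

  iter-fixpoint : ∀ {x} → f x ≡ x → ∀ k → iter f k x ≡ x
  iter-fixpoint fx≡x zero = refl
  iter-fixpoint fx≡x (suc k) = trans (cong f (iter-fixpoint fx≡x k)) fx≡x

  iter-≤ : (∀ x → f x ≤ x) → ∀ k x → iter f k x ≤ x
  iter-≤ deflationary zero x = ≤-refl
  iter-≤ deflationary (suc k) x = ≤-trans (deflationary _) (iter-≤ deflationary k x)

  IterLimit-fixpoint : ∀ {x} → f x ≡ x → IterLimit f x x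
  IterLimit-fixpoint fx≡x = 0 , λ k _ → iter-fixpoint fx≡x k

  IterLimit-≤ : (∀ x → f x ≤ x) → ∀ {x y} → IterLimit f x y → y ≤ x
  IterLimit-≤ deflationary {x} (K , lim) = subst (_≤ x) (lim K ≤-refl) (iter-≤ deflationary K x)

  IterLimit-step : ∀ {x y} → IterLimit f x y → IterLimit f (f x) y
  IterLimit-step {x} (K , lim) = K , λ k K≤k → trans (iter-comm k x) (lim (suc k) (m≤n⇒m≤1+n K≤k))

  IterLimit-unstep : ∀ {x y} → IterLimit f (f x) y → IterLimit f x y
  IterLimit-unstep {x} (K , lim) = suc K , λ where
    (suc k) (s≤s K≤k) → trans (sym (iter-comm k x)) (lim k K≤k)

InV-iotaBar : ∀ {ℓ x} → InV ℓ x → InV ℓ (iotaBar x)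
InV-iotaBar (y , lim , F≤y) = y , IterLimit-step lim , F≤y

InV-iotaBar⁻ : ∀ {ℓ x y} → iotaBar x ≡ y → InV ℓ y → InV ℓ x
InV-iotaBar⁻ refl (z , lim , F≤z) = z , IterLimit-unstep lim , F≤z

InV-F : ∀ m → InV (suc m) (F (suc m))
InV-F m = F (suc m) , IterLimit-fixpoint (iotaBar-fib m) , ≤-refl

InV⇒F≤ : ∀ {ℓ x} → InV ℓ x → F ℓ ≤ x
InV⇒F≤ (y , lim , F≤y) = ≤-trans F≤y (IterLimit-≤ iotaBar-≤ lim)

fib-3+ : ∀ j → fib (3 + j) ≡ 2 * fib (1 + j) + fib j
fib-3+ j = identity (fib j) (fib (1 + j))
  where
  identity : ∀ a b → (b + a) + b ≡ 2 * b + a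
  identity = solve-∀

fib-4+ : ∀ j → fib (4 + j) ≡ 2 * fib (1 + j) + (fib (2 + j) + fib j)
fib-4+ j = identity (fib j) (fib (1 + j))
  where
  identity : ∀ a b → ((b + a) + b) + (b + a) ≡ 2 * b + ((b + a) + a)
  identity = solve-∀

∸-between : ∀ {a b c x} → c + a < x → x < c + b → a < x ∸ c × x ∸ c < b
∸-between {a} {b} {c} {x} c+a<x x<c+b =
  +-cancelˡ-< c a (x ∸ c) (subst (c + a <_) x≡c+[x∸c] c+a<x) ,
  +-cancelˡ-< c (x ∸ c) b (subst (_< c + b) x≡c+[x∸c] x<c+b)
  where
  x≡c+[x∸c] : x ≡ c + (x ∸ c)
  x≡c+[x∸c] = sym (m+[n∸m]≡n (≤-trans (m≤m+n c a) (<⇒≤ c+a<x)))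

module _ (j : ℕ) where

  iotaBar-into : ∀ {x} → fib (3 + j) < x → x < fib (4 + j) →
                 fib j < iotaBar x × iotaBar x < fib (2 + j) + fib j
  iotaBar-into {x} lo hi rewrite iotaBar-between j x lo hi =
    ∸-between (subst (_< x) (fib-3+ j) lo) (subst (x <_) (fib-4+ j) hi)

  iotaBar-mono : ∀ {x y} → fib (3 + j) < x → x < fib (4 + j) → fib (3 + j) < y → y < fib (4 + j) →
                 x < y → iotaBar x < iotaBar y
  iotaBar-mono {x} {y} lox hix loy hiy x<y
    rewrite iotaBar-between j x lox hix | iotaBar-between j y loy hiy =
    ∸-monoˡ-< x<y (≤-trans (m≤m+n _ (fib j)) (<⇒≤ (subst (_< x) (fib-3+ j) lox)))

  iotaBar-onto : ∀ {y} → fib j < y → y < fib (2 + j) + fib j →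
                 Σ ℕ λ x → fib (3 + j) < x × x < fib (4 + j) × iotaBar x ≡ y
  iotaBar-onto {y} lo hi = c + y , lo′ , hi′ , trans (iotaBar-between j (c + y) lo′ hi′) (m+n∸m≡n c y)
    where
    c = 2 * fib (1 + j)
    lo′ : fib (3 + j) < c + y
    lo′ = subst (_< c + y) (sym (fib-3+ j)) (+-monoʳ-< c lo)
    hi′ : c + y < fib (4 + j)
    hi′ = subst (c + y <_) (sym (fib-4+ j)) (+-monoʳ-< c hi)

lemma4p3 : (ℓ : ℕ) → 2 ≤ ℓ →
    (InV ℓ (F ℓ) × (∀ x → InV ℓ x → F ℓ ≤ x)) ×
    (∀ i → ℓ ≤ i →
      (∀ x → InV ℓ x → F i < x → x < F (suc i) →
        InV ℓ (iotaBar x) × fib (i ∸ 2) < iotaBar x × iotaBar x < fib i + fib (i ∸ 2)) ×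
      (∀ x y → InV ℓ x → F i < x → x < F (suc i) → InV ℓ y → F i < y → y < F (suc i) →
        x < y → iotaBar x < iotaBar y) ×
      (∀ y → InV ℓ y → fib (i ∸ 2) < y → y < fib i + fib (i ∸ 2) →
        Σ ℕ λ x → InV ℓ x × F i < x × x < F (suc i) × iotaBar x ≡ y))
lemma4p3 ℓ@(suc (suc m)) (s≤s (s≤s z≤n)) = (InV-F (suc m) , λ _ → InV⇒F≤ {ℓ}) , λ where
  (suc zero) (s≤s ())
  (suc (suc j)) _ →
    (λ x x∈V lo hi → InV-iotaBar {ℓ} x∈V , iotaBar-into j lo hi) ,
    (λ x y _ lox hix _ loy hiy → iotaBar-mono j lox hix loy hiy) ,
    (λ y y∈V lo hi → let x , lo′ , hi′ , ιx≡y = iotaBar-onto j lo hi in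
                     x , InV-iotaBar⁻ {ℓ} ιx≡y y∈V , lo′ , hi′ , ιx≡y)
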